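{- Let $a,b,c>1$ be integers with $\gcd(a,b)>1$ and let $p\in Q$. If the equation $a^x+b^y=c^z$ has a solution in positive integers which is Type C for $p$, then it has no solution which is Type A, Type B, or Type O for $p$.
   Context: $Q$ is the set of primes dividing all of $a$, $b$, $c$. For $p\in Q$ let $p^{\alpha_p}\parallel a$, $p^{\beta_p}\parallel b$, $p^{\gamma_p}\parallel c$. A solution $(x,y,z)$ is Type A for $p$ if $\alpha_px>\beta_py=\gamma_pz$; Type B if $\beta_py>\alpha_px=\gamma_pz$; Type C if $\gamma_pz>\alpha_px=\beta_py$; Type O if $\alpha_px=\beta_py=\gamma_pz$. -}

module Defs where

open import Data.Nat using (ℕ; suc; _+_; _*_; _^_; _<_)
open import Data.Nat.Divisibility using (_∣_)
open import Data.Product using (_×_)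
open import Relation.Binary.PropositionalEquality using (_≡_)
open import Relation.Nullary using (¬_)

_^_∥_ : ℕ → ℕ → ℕ → Set
p ^ k ∥ n = (p ^ k ∣ n) × ¬ (p ^ suc k ∣ n)

IsSolution : ℕ → ℕ → ℕ → ℕ → ℕ → ℕ → Set
IsSolution a b c x y z = (0 < x) × (0 < y) × (0 < z) × (a ^ x + b ^ y ≡ c ^ z)

-- Types relative to exponents α β γ of p in a b c
TypeA TypeB TypeC TypeO : ℕ → ℕ → ℕ → ℕ → ℕ → ℕ → Set
TypeA α β γ x y z = (β * y < α * x) × (β * y ≡ γ * z)
TypeB α β γ x y z = (α * x < β * y) × (α * x ≡ γ * z)
TypeC α β γ x y z = (α * x < γ * z) × (α * x ≡ β * y)
TypeO α β γ x y z = (α * x ≡ β * y) × (β * y ≡ γ * z)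

{-# OPTIONS --safe #-}
-- Let (x₀, y₀, z₀) be of Type C and (x, y, z) of Type A, B or O, so that
-- αx₀ = βy₀ < γz₀ while γz ≤ αx and γz ≤ βy.  Say a^x₀ ≥ b^y₀.  Then
-- c^z₀ ≤ 2a^x₀ and a^x < c^z, hence c^(z₀x) ≤ 2^x a^(x₀x) < 2^x c^(zx₀).  On the
-- other hand γzx₀ + x ≤ (αx₀ + 1)x ≤ γz₀x, and as 2^γ ≤ p^γ ≤ c this forces
-- 2^x c^(zx₀) ≤ c^(z₀x).
module Submission where

open import Defs
open import Data.Nat using (ℕ; _<_)
open import Data.Nat.Divisibility using (_∣_)
open import Data.Nat.GCD using (gcd)
open import Data.Nat.Primality using (Prime)
open import Data.Product using (_×_; ∃-syntax)
open import Data.Sum using (_⊎_)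
open import Relation.Nullary using (¬_)

open import Data.Nat using (zero; suc; _+_; _*_; _∸_; _^_; _≤_; NonZero; >-nonZero; nonTrivial⇒n>1)
open import Data.Nat.Properties
open import Data.Nat.Divisibility using (∣⇒≤)
open import Data.Nat.Primality using (prime⇒nonTrivial)
open import Data.Nat.Tactic.RingSolver using (solve-∀)
open import Data.Product using (_,_; proj₁; proj₂)
open import Data.Sum using (inj₁; inj₂; [_,_]′)
open import Data.Empty using (⊥)
open import Relation.Binary.PropositionalEquality using (_≡_; refl; sym; trans; cong; subst; module ≡-Reasoning)

^-distribʳ-* : ∀ m n o → (m * n) ^ o ≡ m ^ o * n ^ o
^-distribʳ-* m n zero    = refl
^-distribʳ-* m n (suc o) = begin
  m * n * (m * n) ^ o      ≡⟨ cong (m * n *_) (^-distribʳ-* m n o) ⟩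
  m * n * (m ^ o * n ^ o)  ≡⟨ interchange m n (m ^ o) (n ^ o) ⟩
  m * m ^ o * (n * n ^ o)  ∎
  where
  open ≡-Reasoning
  interchange : ∀ m n u v → m * n * (u * v) ≡ m * u * (n * v)
  interchange = solve-∀

p^k∣n⇒2^k≤n : ∀ {p} k {n} .{{_ : NonZero n}} → Prime p → p ^ k ∣ n → 2 ^ k ≤ n
p^k∣n⇒2^k≤n {p} k p-prime pᵏ∣n =
  ≤-trans (^-monoˡ-≤ k (nonTrivial⇒n>1 p {{prime⇒nonTrivial p-prime}})) (∣⇒≤ pᵏ∣n)

2^d*c^m≤c^n : ∀ {c d} k m n → 2 ^ k ≤ c → 0 < d → k * m + d ≤ k * n → 2 ^ d * c ^ m ≤ c ^ n
2^d*c^m≤c^n {c} {d} k m n 2ᵏ≤c 0<d km+d≤kn = begin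
  2 ^ d * c ^ m        ≤⟨ *-monoˡ-≤ (c ^ m) 2ᵈ≤cᵉ ⟩
  c ^ e * c ^ m        ≡⟨ ^-distribˡ-+-* c e m ⟨
  c ^ (e + m)          ≡⟨ cong (c ^_) (m∸n+n≡m m≤n) ⟩
  c ^ n                ∎
  where
  open ≤-Reasoning
  e : ℕ
  e = n ∸ m
  m≤n : m ≤ n
  m≤n = <⇒≤ (*-cancelˡ-< k m n (<-≤-trans (m<m+n (k * m) 0<d) km+d≤kn))
  d≤ke : d ≤ k * e
  d≤ke = +-cancelˡ-≤ (k * m) d (k * e)
    (subst (k * m + d ≤_) (trans (cong (k *_) (sym (m+[n∸m]≡n m≤n))) (*-distribˡ-+ k m e)) km+d≤kn)
  2ᵈ≤cᵉ : 2 ^ d ≤ c ^ e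
  2ᵈ≤cᵉ = begin
    2 ^ d        ≤⟨ ^-monoʳ-≤ 2 d≤ke ⟩
    2 ^ (k * e)  ≡⟨ ^-*-assoc 2 k e ⟨
    (2 ^ k) ^ e  ≤⟨ ^-monoˡ-≤ e 2ᵏ≤c ⟩
    c ^ e        ∎

exponent-gap : ∀ k γ {x₀ z₀ x z} → k * x₀ < γ * z₀ → γ * z ≤ k * x →
  γ * (z * x₀) + x ≤ γ * (z₀ * x)
exponent-gap k γ {x₀} {z₀} {x} {z} kx₀<γz₀ γz≤kx = begin
  γ * (z * x₀) + x     ≡⟨ cong (_+ x) (*-assoc γ z x₀) ⟨
  γ * z * x₀ + x       ≤⟨ +-monoˡ-≤ x (*-monoˡ-≤ x₀ γz≤kx) ⟩
  k * x * x₀ + x       ≡⟨ regroup k x x₀ ⟩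
  suc (k * x₀) * x     ≤⟨ *-monoˡ-≤ x kx₀<γz₀ ⟩
  γ * z₀ * x           ≡⟨ *-assoc γ z₀ x ⟩
  γ * (z₀ * x)         ∎
  where
  open ≤-Reasoning
  regroup : ∀ k x x₀ → k * x * x₀ + x ≡ (1 + k * x₀) * x
  regroup = solve-∀

c^[z₀x]<2^x*c^[zx₀] : ∀ c u x₀ z₀ x z .{{_ : NonZero x₀}} →
  c ^ z₀ ≤ 2 * u ^ x₀ → u ^ x < c ^ z → c ^ (z₀ * x) < 2 ^ x * c ^ (z * x₀)
c^[z₀x]<2^x*c^[zx₀] c u x₀ z₀ x z cᶻ⁰≤2uˣ⁰ uˣ<cᶻ = begin-strict
  c ^ (z₀ * x)           ≡⟨ ^-*-assoc c z₀ x ⟨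
  (c ^ z₀) ^ x           ≤⟨ ^-monoˡ-≤ x cᶻ⁰≤2uˣ⁰ ⟩
  (2 * u ^ x₀) ^ x       ≡⟨ ^-distribʳ-* 2 (u ^ x₀) x ⟩
  2 ^ x * (u ^ x₀) ^ x   ≡⟨ cong (2 ^ x *_) (^-*-assoc u x₀ x) ⟩
  2 ^ x * u ^ (x₀ * x)   ≡⟨ cong (λ e → 2 ^ x * u ^ e) (*-comm x₀ x) ⟩
  2 ^ x * u ^ (x * x₀)   ≡⟨ cong (2 ^ x *_) (^-*-assoc u x x₀) ⟨
  2 ^ x * (u ^ x) ^ x₀   <⟨ *-monoʳ-< (2 ^ x) {{m^n≢0 2 x}} (^-monoˡ-< x₀ uˣ<cᶻ) ⟩
  2 ^ x * (c ^ z) ^ x₀   ≡⟨ cong (2 ^ x *_) (^-*-assoc c z x₀) ⟩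
  2 ^ x * c ^ (z * x₀)   ∎
  where open ≤-Reasoning

dominant-summand-contradiction : ∀ c u k γ x₀ z₀ x z → 2 ^ γ ≤ c → 0 < x₀ → 0 < x →
  c ^ z₀ ≤ 2 * u ^ x₀ → u ^ x < c ^ z → k * x₀ < γ * z₀ → γ * z ≤ k * x → ⊥
dominant-summand-contradiction c u k γ x₀ z₀ x z 2ᵞ≤c 0<x₀ 0<x cᶻ⁰≤2uˣ⁰ uˣ<cᶻ kx₀<γz₀ γz≤kx =
  <-irrefl refl (<-≤-trans
    (c^[z₀x]<2^x*c^[zx₀] c u x₀ z₀ x z {{>-nonZero 0<x₀}} cᶻ⁰≤2uˣ⁰ uˣ<cᶻ)
    (2^d*c^m≤c^n γ (z * x₀) (z₀ * x) 2ᵞ≤c 0<x (exponent-gap k γ kx₀<γz₀ γz≤kx)))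

typeABO⇒γz≤αx×γz≤βy : ∀ α β γ x y z → TypeA α β γ x y z ⊎ TypeB α β γ x y z ⊎ TypeO α β γ x y z →
  γ * z ≤ α * x × γ * z ≤ β * y
typeABO⇒γz≤αx×γz≤βy α β γ x y z (inj₁ (βy<αx , βy≡γz)) =
  subst (_≤ α * x) βy≡γz (<⇒≤ βy<αx) , ≤-reflexive (sym βy≡γz)
typeABO⇒γz≤αx×γz≤βy α β γ x y z (inj₂ (inj₁ (αx<βy , αx≡γz))) =
  ≤-reflexive (sym αx≡γz) , subst (_≤ β * y) αx≡γz (<⇒≤ αx<βy)
typeABO⇒γz≤αx×γz≤βy α β γ x y z (inj₂ (inj₂ (αx≡βy , βy≡γz))) =
  ≤-reflexive (sym (trans αx≡βy βy≡γz)) , ≤-reflexive (sym βy≡γz)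

m≤n⇒m+n≤2*n : ∀ {m n} → m ≤ n → m + n ≤ 2 * n
m≤n⇒m+n≤2*n {m} {n} m≤n = subst (m + n ≤_) (cong (n +_) (sym (+-identityʳ n))) (+-monoˡ-≤ n m≤n)

proposition3p2 : (a b c : ℕ) → 1 < a → 1 < b → 1 < c → 1 < gcd a b →
    (p : ℕ) → Prime p → p ∣ a → p ∣ b → p ∣ c →
    (α β γ : ℕ) → p ^ α ∥ a → p ^ β ∥ b → p ^ γ ∥ c →
    (∃[ x ] ∃[ y ] ∃[ z ] (IsSolution a b c x y z × TypeC α β γ x y z)) →
    (x y z : ℕ) → IsSolution a b c x y z →
    ¬ (TypeA α β γ x y z ⊎ TypeB α β γ x y z ⊎ TypeO α β γ x y z)
proposition3p2 a b c 1<a 1<b 1<c _ p p-prime _ _ _ α β γ _ _ (pᵞ∣c , _)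
  (x₀ , y₀ , z₀ , (0<x₀ , 0<y₀ , _ , sol₀) , (αx₀<γz₀ , αx₀≡βy₀)) x y z (0<x , 0<y , _ , sol) typeABO =
  [ bʸ⁰-dominant , aˣ⁰-dominant ]′ (≤-total (a ^ x₀) (b ^ y₀))
  where
  instance
    a≢0 : NonZero a
    a≢0 = >-nonZero (<⇒≤ 1<a)
    b≢0 : NonZero b
    b≢0 = >-nonZero (<⇒≤ 1<b)
    c≢0 : NonZero c
    c≢0 = >-nonZero (<⇒≤ 1<c)
  2ᵞ≤c : 2 ^ γ ≤ c
  2ᵞ≤c = p^k∣n⇒2^k≤n γ p-prime pᵞ∣c
  γz≤αx×γz≤βy : γ * z ≤ α * x × γ * z ≤ β * y
  γz≤αx×γz≤βy = typeABO⇒γz≤αx×γz≤βy α β γ x y z typeABO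
  aˣ⁰-dominant : b ^ y₀ ≤ a ^ x₀ → ⊥
  aˣ⁰-dominant bʸ⁰≤aˣ⁰ = dominant-summand-contradiction c a α γ x₀ z₀ x z 2ᵞ≤c 0<x₀ 0<x
    (subst (_≤ 2 * a ^ x₀) (trans (+-comm (b ^ y₀) (a ^ x₀)) sol₀) (m≤n⇒m+n≤2*n bʸ⁰≤aˣ⁰))
    (subst (a ^ x <_) sol (m<m+n (a ^ x) (m^n>0 b y)))
    αx₀<γz₀ (proj₁ γz≤αx×γz≤βy)
  bʸ⁰-dominant : a ^ x₀ ≤ b ^ y₀ → ⊥
  bʸ⁰-dominant aˣ⁰≤bʸ⁰ = dominant-summand-contradiction c b β γ y₀ z₀ y z 2ᵞ≤c 0<y₀ 0<y
    (subst (_≤ 2 * b ^ y₀) sol₀ (m≤n⇒m+n≤2*n aˣ⁰≤bʸ⁰))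
    (subst (b ^ y <_) (trans (+-comm (b ^ y) (a ^ x)) sol) (m<m+n (b ^ y) (m^n>0 a x)))
    (subst (_< γ * z₀) αx₀≡βy₀ αx₀<γz₀) (proj₂ γz≤αx×γz≤βy)
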